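{- There exists $p_0$ such that for every prime $p > p_0$, with $n = 4p$, the set $fM \subset \mathbb{R}^{n^2}$ cannot be partitioned into $n^2+1$ parts each of diameter strictly smaller than the diameter of $fM$.
   Context: For a positive integer $n$, let $E_2^n=\{(x_1,\dots,x_n)\in\mathbb{R}^n : x_i=\pm 1 \text{ for all } i\}$ be the set of vertices of the $n$-dimensional cube. Let $M=\{x\in E_2^n : x_1=1 \text{ and the number of indices } i \text{ with } x_i=-1 \text{ is even}\}$. Define $f:E_2^n\to E_2^{n^2}\subset\mathbb{R}^{n^2}$ by $f(x_1,\dots,x_n)=(x_ix_j)_{1\le i,j\le n}$, where the coordinates of $\mathbb{R}^{n^2}$ are indexed by pairs $(i,j)$ with $1\le i,j\le n$. Distances are Euclidean, and the diameter of a set is the supremum of distances between its points. -}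

module Defs where

open import Data.Nat using (ℕ; zero; suc; _*_; _+_)
open import Data.Nat.Divisibility using (_∣_)
open import Data.Fin using (Fin; zero; suc; toℕ)
open import Data.Integer as ℤ using (ℤ; +_; -[1+_])
open import Data.Product using (Σ; _×_; ∃-syntax)
open import Data.Sum using (_⊎_)
open import Relation.Binary.PropositionalEquality using (_≡_)

-- A point of ℝⁿ with integer coordinates, as a functional vector.
Pt : ℕ → Set
Pt n = Fin n → ℤ

InCube : (n : ℕ) → Pt n → Set
InCube n x = ∀ i → (x i ≡ + 1) ⊎ (x i ≡ -[1+ 0 ])

countNeg : (n : ℕ) → Pt n → ℕ
countNeg zero    x = 0
countNeg (suc n) x with x zero
... | -[1+ 0 ] = suc (countNeg n (λ i → x (suc i)))
... | _        = countNeg n (λ i → x (suc i))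

InM : (n : ℕ) → Pt n → Set
InM n x = InCube n x × (∀ i → toℕ i ≡ 0 → x i ≡ + 1) × (2 ∣ countNeg n x)

f : (n : ℕ) → Pt n → (Fin n → Fin n → ℤ)
f n x i j = x i ℤ.* x j

sumFin : (n : ℕ) → (Fin n → ℤ) → ℤ
sumFin zero    g = + 0
sumFin (suc n) g = g zero ℤ.+ sumFin n (λ i → g (suc i))

distSq : (n : ℕ) → (Fin n → Fin n → ℤ) → (Fin n → Fin n → ℤ) → ℤ
distSq n a b = sumFin n (λ i → sumFin n (λ j → (a i j ℤ.- b i j) ℤ.* (a i j ℤ.- b i j)))

-- D is the square of the diameter of fM (supremum, attained since M is finite)
IsDiamSqFM : (n : ℕ) → ℤ → Set
IsDiamSqFM n D =
  (∀ x y → InM n x → InM n y → distSq n (f n x) (f n y) ℤ.≤ D) ×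
  (∃[ x ] ∃[ y ] (InM n x × InM n y × distSq n (f n x) (f n y) ≡ D))

-- fM can be partitioned into k parts (colour classes of c; empty parts allowed,
-- i.e. "at most k parts") each of diameter strictly smaller than diam fM.
-- For a finite part, diameter < diam fM iff every pairwise distance is < diam fM;
-- distances compared via their squares (monotone on nonnegatives).
PartitionableSmaller : (n k : ℕ) → ℤ → Set
PartitionableSmaller n k D =
  Σ (Pt n → Fin k) λ c →
    ∀ x y → InM n x → InM n y → c x ≡ c y →
      distSq n (f n x) (f n y) ℤ.< D

module Submission where

-- For x, y ∈ {±1}ⁿ one has |f x − f y|² = 2n² − 2⟨x, y⟩², so the squared diameter of fM is at
-- most 2n², orthogonal pairs attain it, and a part of smaller diameter contains no orthogonal
-- pair. For n = 4p and distinct x, y ∈ M, ⟨x, y⟩ ≡ 0 (mod 4) and |⟨x, y⟩| < n, so a nonzero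
-- ⟨x, y⟩ is not divisible by p. By Frankl–Wilson, the multilinear polynomials
-- Fₓ(z) = ∏_{k=1}^{p−1} (k − ⟨x, z⟩) of degree p − 1 then satisfy Fₓ(x) ≢ 0 and Fₓ(y) ≡ 0 (mod p)
-- within a part, so they are linearly independent modulo p and a part has at most
-- Σ_{i<p} C(n, i) points. As (n² + 1) Σ_{i<p} C(n, i) < 2^(n−2) = |M| once p ≥ 20, the n² + 1
-- parts cannot cover M.

open import Defs
open import Data.Nat as ℕ using (ℕ; zero; suc)
import Data.Nat.Properties as ℕP
import Data.Nat.Divisibility as ℕD
open import Data.Nat.Primality using (Prime; euclidsLemma; ¬prime[1]; prime⇒nonZero)
open import Algebra.Properties.CommutativeMonoid.Sum ℕP.+-0-commutativeMonoid
  using (sum-syntax; ∑-comm; sum-cong-≗)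
open import Data.Integer as ℤ using (ℤ; +_; -[1+_]; _+_; _*_; -_; _-_)
import Data.Integer.Properties as ℤP
open import Data.Integer.Divisibility.Signed
  using (_∣_; divides; _∣?_; ∣ᵤ⇒∣; ∣⇒∣ᵤ; ∣m∣n⇒∣m+n; ∣n⇒∣m*n; ∣m⇒∣m*n; ∣m+n∣n⇒∣m)
open import Data.Integer.DivMod using (_%ℕ_; _/ℕ_; a≡a%ℕn+[a/ℕn]*n; n%ℕd<d)
open import Data.Integer.Tactic.RingSolver using (solve-∀)
import Data.Nat.Tactic.RingSolver as ℕ-Ring
open import Data.Fin using (Fin; zero; suc; toℕ; punchIn; _↑ˡ_; _↑ʳ_; splitAt; join)
import Data.Fin.Properties as FinP
open import Data.Vec.Functional using (insertAt; tail; _++_; _∷_)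
open import Data.Vec.Functional.Properties
  using (insertAt-lookup; insertAt-punchIn; lookup-++ˡ; lookup-++ʳ)
open import Data.Product using (Σ; ∃-syntax; _×_; _,_; proj₁; proj₂)
open import Data.Sum using (_⊎_; inj₁; inj₂)
open import Data.Empty using (⊥-elim)
open import Data.Unit using (tt)
open import Function using (_$_)
open import Relation.Nullary using (¬_; ¬?; yes; no)
open import Relation.Binary.PropositionalEquality

sumFin-cong : ∀ n {g h : Fin n → ℤ} → (∀ i → g i ≡ h i) → sumFin n g ≡ sumFin n h
sumFin-cong zero    g≗h = refl
sumFin-cong (suc n) g≗h = cong₂ _+_ (g≗h zero) (sumFin-cong n (λ i → g≗h (suc i)))

sumFin-+ : ∀ n (g h : Fin n → ℤ) → sumFin n (λ i → g i + h i) ≡ sumFin n g + sumFin n h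
sumFin-+ zero    g h = refl
sumFin-+ (suc n) g h rewrite sumFin-+ n (λ i → g (suc i)) (λ i → h (suc i)) =
  interchange (g zero) (h zero) _ _
  where
  interchange : ∀ a b c d → a + b + (c + d) ≡ a + c + (b + d)
  interchange = solve-∀

sumFin-*ˡ : ∀ n k (g : Fin n → ℤ) → sumFin n (λ i → k * g i) ≡ k * sumFin n g
sumFin-*ˡ zero    k g = sym (ℤP.*-zeroʳ k)
sumFin-*ˡ (suc n) k g rewrite sumFin-*ˡ n k (λ i → g (suc i)) =
  sym (ℤP.*-distribˡ-+ k (g zero) _)

sumFin-*ʳ : ∀ n k (g : Fin n → ℤ) → sumFin n (λ i → g i * k) ≡ sumFin n g * k
sumFin-*ʳ n k g = begin
  sumFin n (λ i → g i * k)  ≡⟨ sumFin-cong n (λ i → ℤP.*-comm (g i) k) ⟩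
  sumFin n (λ i → k * g i)  ≡⟨ sumFin-*ˡ n k g ⟩
  k * sumFin n g            ≡⟨ ℤP.*-comm k _ ⟩
  sumFin n g * k            ∎
  where open ≡-Reasoning

sumFin-const : ∀ n c → sumFin n (λ _ → c) ≡ c * + n
sumFin-const zero    c = sym (ℤP.*-zeroʳ c)
sumFin-const (suc n) c = begin
  c + sumFin n (λ _ → c)  ≡⟨ cong (_+_ c) (sumFin-const n c) ⟩
  c + c * + n             ≡⟨ lemma c (+ n) ⟩
  c * (+ 1 + + n)         ∎
  where
  open ≡-Reasoning
  lemma : ∀ c m → c + c * m ≡ c * (+ 1 + m)
  lemma = solve-∀

sumFin-punchIn : ∀ m (j : Fin (suc m)) (g : Fin (suc m) → ℤ) →
  sumFin (suc m) g ≡ g j + sumFin m (λ l → g (punchIn j l))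
sumFin-punchIn m       zero    g = refl
sumFin-punchIn (suc m) (suc j) g rewrite sumFin-punchIn m j (λ i → g (suc i)) =
  swap-front (g zero) (g (suc j)) _
  where
  swap-front : ∀ a b c → a + (b + c) ≡ b + (a + c)
  swap-front = solve-∀

∣sumFin : ∀ {q} n (g : Fin n → ℤ) → (∀ i → q ∣ g i) → q ∣ sumFin n g
∣sumFin zero    g q∣g = divides (+ 0) refl
∣sumFin (suc n) g q∣g = ∣m∣n⇒∣m+n (q∣g zero) (∣sumFin n _ (λ i → q∣g (suc i)))

-- Multilinear polynomials

-- dim n k counts the multilinear monomials of degree ≤ k in n variables, dim⁻ n k those of degree < k.
mutual
  dim : ℕ → ℕ → ℕ
  dim zero    k = 1
  dim (suc n) k = dim n k ℕ.+ dim⁻ n k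

  dim⁻ : ℕ → ℕ → ℕ
  dim⁻ n zero    = 0
  dim⁻ n (suc k) = dim n k

-- The coefficients of P ∈ Poly (suc n) k are those of P₀ followed by those of P₁,
-- where P(z) = P₀(z₁,…) + z₀ P₁(z₁,…).
Poly : ℕ → ℕ → Set
Poly n k = Fin (dim n k) → ℤ

Poly⁻ : ℕ → ℕ → Set
Poly⁻ n k = Fin (dim⁻ n k) → ℤ

constPart : ∀ n k → Poly (suc n) k → Poly n k
constPart n k P i = P (i ↑ˡ dim⁻ n k)

linPart : ∀ n k → Poly (suc n) k → Poly⁻ n k
linPart n k P i = P (dim n k ↑ʳ i)

mutual
  eval : ∀ n k → Poly n k → Pt n → ℤ
  eval zero    k P z = P zero
  eval (suc n) k P z = eval n k (constPart n k P) (tail z) + z zero * eval⁻ n k (linPart n k P) (tail z)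

  eval⁻ : ∀ n k → Poly⁻ n k → Pt n → ℤ
  eval⁻ n zero    Q z = + 0
  eval⁻ n (suc k) Q z = eval n k Q z

mutual
  eval-cong : ∀ n k {P Q : Poly n k} → (∀ t → P t ≡ Q t) → ∀ z → eval n k P z ≡ eval n k Q z
  eval-cong zero    k P≗Q z = P≗Q zero
  eval-cong (suc n) k P≗Q z =
    cong₂ _+_ (eval-cong n k (λ t → P≗Q _) (tail z)) (cong (z zero *_) (eval⁻-cong n k (λ t → P≗Q _) (tail z)))

  eval⁻-cong : ∀ n k {P Q : Poly⁻ n k} → (∀ t → P t ≡ Q t) → ∀ z → eval⁻ n k P z ≡ eval⁻ n k Q z
  eval⁻-cong n zero    P≗Q z = refl
  eval⁻-cong n (suc k) P≗Q z = eval-cong n k P≗Q z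

mutual
  eval-+ : ∀ n k (P Q : Poly n k) z → eval n k (λ t → P t + Q t) z ≡ eval n k P z + eval n k Q z
  eval-+ zero    k P Q z = refl
  eval-+ (suc n) k P Q z
    rewrite eval-+ n k (constPart n k P) (constPart n k Q) (tail z)
          | eval⁻-+ n k (linPart n k P) (linPart n k Q) (tail z) =
    ring (eval n k (constPart n k P) (tail z)) (eval n k (constPart n k Q) (tail z))
         (eval⁻ n k (linPart n k P) (tail z)) (eval⁻ n k (linPart n k Q) (tail z)) (z zero)
    where
    ring : ∀ a b c d x → a + b + x * (c + d) ≡ a + x * c + (b + x * d)
    ring = solve-∀

  eval⁻-+ : ∀ n k (P Q : Poly⁻ n k) z → eval⁻ n k (λ t → P t + Q t) z ≡ eval⁻ n k P z + eval⁻ n k Q z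
  eval⁻-+ n zero    P Q z = refl
  eval⁻-+ n (suc k) P Q z = eval-+ n k P Q z

mutual
  eval-* : ∀ n k a (P : Poly n k) z → eval n k (λ t → a * P t) z ≡ a * eval n k P z
  eval-* zero    k a P z = refl
  eval-* (suc n) k a P z
    rewrite eval-* n k a (constPart n k P) (tail z)
          | eval⁻-* n k a (linPart n k P) (tail z) =
    ring a (eval n k (constPart n k P) (tail z)) (eval⁻ n k (linPart n k P) (tail z)) (z zero)
    where
    ring : ∀ a b c x → a * b + x * (a * c) ≡ a * (b + x * c)
    ring = solve-∀

  eval⁻-* : ∀ n k a (P : Poly⁻ n k) z → eval⁻ n k (λ t → a * P t) z ≡ a * eval⁻ n k P z
  eval⁻-* n zero    a P z = sym (ℤP.*-zeroʳ a)
  eval⁻-* n (suc k) a P z = eval-* n k a P z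

eval-0 : ∀ n k z → eval n k (λ _ → + 0) z ≡ + 0
eval-0 n k z = eval-* n k (+ 0) (λ _ → + 0) z

eval-sumFin : ∀ n k m (c : Fin m → ℤ) (P : Fin m → Poly n k) z →
  eval n k (λ t → sumFin m (λ j → c j * P j t)) z ≡ sumFin m (λ j → c j * eval n k (P j) z)
eval-sumFin n k zero    c P z = eval-0 n k z
eval-sumFin n k (suc m) c P z = trans (eval-+ n k _ _ z)
  (cong₂ _+_ (eval-* n k (c zero) (P zero) z) (eval-sumFin n k m (λ j → c (suc j)) (λ j → P (suc j)) z))

eval-++ : ∀ n k (P₀ : Poly n k) (P₁ : Poly⁻ n k) z →
  eval (suc n) k (P₀ ++ P₁) z ≡ eval n k P₀ (tail z) + z zero * eval⁻ n k P₁ (tail z)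
eval-++ n k P₀ P₁ z = cong₂ _+_
  (eval-cong n k (lookup-++ˡ P₀ P₁) (tail z))
  (cong (z zero *_) (eval⁻-cong n k (lookup-++ʳ P₀ P₁) (tail z)))

∣eval : ∀ {q} n k (P : Poly n k) z → (∀ t → q ∣ P t) → q ∣ eval n k P z
∣eval⁻ : ∀ {q} n k (P : Poly⁻ n k) z → (∀ t → q ∣ P t) → q ∣ eval⁻ n k P z
∣eval zero    k P z q∣P = q∣P zero
∣eval (suc n) k P z q∣P =
  ∣m∣n⇒∣m+n (∣eval n k _ (tail z) (λ t → q∣P _)) (∣n⇒∣m*n (z zero) (∣eval⁻ n k _ (tail z) (λ t → q∣P _)))
∣eval⁻ n zero    P z q∣P = divides (+ 0) refl
∣eval⁻ n (suc k) P z q∣P = ∣eval n k P z q∣P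

mutual
  raise : ∀ n k → Poly n k → Poly n (suc k)
  raise zero    k P = P
  raise (suc n) k P = raise n k (constPart n k P) ++ raise⁻ n k (linPart n k P)

  raise⁻ : ∀ n k → Poly⁻ n k → Poly⁻ n (suc k)
  raise⁻ n zero    Q = λ _ → + 0
  raise⁻ n (suc k) Q = raise n k Q

mutual
  eval-raise : ∀ n k P z → eval n (suc k) (raise n k P) z ≡ eval n k P z
  eval-raise zero    k P z = refl
  eval-raise (suc n) k P z = trans (eval-++ n (suc k) _ _ z)
    (cong₂ _+_ (eval-raise n k _ (tail z)) (cong (z zero *_) (eval⁻-raise⁻ n k _ (tail z))))

  eval⁻-raise⁻ : ∀ n k Q z → eval⁻ n (suc k) (raise⁻ n k Q) z ≡ eval⁻ n k Q z
  eval⁻-raise⁻ n zero    Q z = eval-0 n zero z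
  eval⁻-raise⁻ n (suc k) Q z = eval-raise n k Q z

fromPoly⁻ : ∀ n k → Poly⁻ n k → Poly n (suc k)
fromPoly⁻ n zero    Q = λ _ → + 0
fromPoly⁻ n (suc k) Q = raise n (suc k) (raise n k Q)

eval-fromPoly⁻ : ∀ n k Q z → eval n (suc k) (fromPoly⁻ n k Q) z ≡ eval⁻ n k Q z
eval-fromPoly⁻ n zero    Q z = eval-0 n 1 z
eval-fromPoly⁻ n (suc k) Q z = trans (eval-raise n (suc k) _ z) (eval-raise n k Q z)

OnCube : ∀ {n} → Pt n → Set
OnCube z = ∀ i → z i * z i ≡ + 1

-- Multiplication by the variable zᵢ, using zᵢ² = 1 to stay multilinear.
mutual
  mulVar : ∀ n k → Fin n → Poly n k → Poly n (suc k)
  mulVar (suc n) k zero    P = fromPoly⁻ n k (linPart n k P) ++ constPart n k P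
  mulVar (suc n) k (suc i) P = mulVar n k i (constPart n k P) ++ mulVar⁻ n k i (linPart n k P)

  mulVar⁻ : ∀ n k → Fin n → Poly⁻ n k → Poly⁻ n (suc k)
  mulVar⁻ n zero    i Q = λ _ → + 0
  mulVar⁻ n (suc k) i Q = mulVar n k i Q

mutual
  eval-mulVar : ∀ n k i P z → OnCube z → eval n (suc k) (mulVar n k i P) z ≡ z i * eval n k P z
  eval-mulVar (suc n) k zero P z z²≡1 = begin
    eval (suc n) (suc k) (fromPoly⁻ n k P₁ ++ P₀) z  ≡⟨ eval-++ n (suc k) _ P₀ z ⟩
    eval n (suc k) (fromPoly⁻ n k P₁) z′ + z₀ * eval n k P₀ z′
      ≡⟨ cong (_+ z₀ * eval n k P₀ z′) (eval-fromPoly⁻ n k P₁ z′) ⟩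
    eval⁻ n k P₁ z′ + z₀ * eval n k P₀ z′
      ≡⟨ cong (_+ z₀ * eval n k P₀ z′) (sym (trans (cong (_* eval⁻ n k P₁ z′) (z²≡1 zero)) (ℤP.*-identityˡ _))) ⟩
    z₀ * z₀ * eval⁻ n k P₁ z′ + z₀ * eval n k P₀ z′  ≡⟨ ring z₀ (eval n k P₀ z′) (eval⁻ n k P₁ z′) ⟩
    z₀ * (eval n k P₀ z′ + z₀ * eval⁻ n k P₁ z′)     ∎
    where
    open ≡-Reasoning
    z₀ = z zero
    z′ = tail z
    P₀ = constPart n k P
    P₁ = linPart n k P
    ring : ∀ x a b → x * x * b + x * a ≡ x * (a + x * b)
    ring = solve-∀
  eval-mulVar (suc n) k (suc i) P z z²≡1 = trans (eval-++ n (suc k) _ _ z)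
    (trans (cong₂ _+_ (eval-mulVar n k i _ (tail z) (λ j → z²≡1 (suc j)))
                      (cong (z zero *_) (eval⁻-mulVar⁻ n k i _ (tail z) (λ j → z²≡1 (suc j)))))
           (ring (z (suc i)) (eval n k (constPart n k P) (tail z)) (eval⁻ n k (linPart n k P) (tail z)) (z zero)))
    where
    ring : ∀ y a b x → y * a + x * (y * b) ≡ y * (a + x * b)
    ring = solve-∀

  eval⁻-mulVar⁻ : ∀ n k i Q z → OnCube z → eval⁻ n (suc k) (mulVar⁻ n k i Q) z ≡ z i * eval⁻ n k Q z
  eval⁻-mulVar⁻ n zero    i Q z z²≡1 = trans (eval-0 n zero z) (sym (ℤP.*-zeroʳ (z i)))
  eval⁻-mulVar⁻ n (suc k) i Q z z²≡1 = eval-mulVar n k i Q z z²≡1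

one : ∀ n → Poly n 0
one zero    = λ _ → + 1
one (suc n) = one n ++ λ ()

eval-one : ∀ n z → eval n 0 (one n) z ≡ + 1
eval-one zero    z = refl
eval-one (suc n) z = trans (eval-++ n 0 (one n) (λ ()) z)
  (cong₂ _+_ (eval-one n (tail z)) (ℤP.*-zeroʳ (z zero)))

dot : ∀ n → Pt n → Pt n → ℤ
dot n x z = sumFin n (λ i → x i * z i)

dot-self : ∀ n x → OnCube x → dot n x x ≡ + n
dot-self n x x²≡1 = trans (sumFin-cong n x²≡1) (trans (sumFin-const n (+ 1)) (ℤP.*-identityˡ (+ n)))

mulDot : ∀ n k → Pt n → Poly n k → Poly n (suc k)
mulDot n k x P t = sumFin n (λ i → x i * mulVar n k i P t)

eval-mulDot : ∀ n k x P z → OnCube z → eval n (suc k) (mulDot n k x P) z ≡ dot n x z * eval n k P z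
eval-mulDot n k x P z z²≡1 = begin
  eval n (suc k) (mulDot n k x P) z                    ≡⟨ eval-sumFin n (suc k) n x (λ i → mulVar n k i P) z ⟩
  sumFin n (λ i → x i * eval n (suc k) (mulVar n k i P) z)
    ≡⟨ sumFin-cong n (λ i → cong (x i *_) (eval-mulVar n k i P z z²≡1)) ⟩
  sumFin n (λ i → x i * (z i * eval n k P z))          ≡⟨ sumFin-cong n (λ i → sym (ℤP.*-assoc (x i) (z i) _)) ⟩
  sumFin n (λ i → x i * z i * eval n k P z)            ≡⟨ sumFin-*ʳ n _ (λ i → x i * z i) ⟩
  dot n x z * eval n k P z                             ∎
  where open ≡-Reasoning

shiftProd : ℕ → ℤ → ℤ
shiftProd zero    s = + 1
shiftProd (suc r) s = (+ suc r - s) * shiftProd r s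

shiftPoly : ∀ n → Pt n → ∀ r → Poly n r
shiftPoly n x zero    = one n
shiftPoly n x (suc r) t = + suc r * raise n r (shiftPoly n x r) t + -[1+ 0 ] * mulDot n r x (shiftPoly n x r) t

eval-shiftPoly : ∀ n x r z → OnCube z → eval n r (shiftPoly n x r) z ≡ shiftProd r (dot n x z)
eval-shiftPoly n x zero    z z²≡1 = eval-one n z
eval-shiftPoly n x (suc r) z z²≡1 = begin
  eval n (suc r) (shiftPoly n x (suc r)) z
    ≡⟨ eval-+ n (suc r) _ _ z ⟩
  eval n (suc r) (λ t → + suc r * R t) z + eval n (suc r) (λ t → -[1+ 0 ] * D t) z
    ≡⟨ cong₂ _+_ (eval-* n (suc r) (+ suc r) R z) (eval-* n (suc r) -[1+ 0 ] D z) ⟩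
  + suc r * eval n (suc r) R z + -[1+ 0 ] * eval n (suc r) D z
    ≡⟨ cong₂ (λ u v → + suc r * u + -[1+ 0 ] * v) (eval-raise n r F z) (eval-mulDot n r x F z z²≡1) ⟩
  + suc r * eval n r F z + -[1+ 0 ] * (dot n x z * eval n r F z)
    ≡⟨ cong (λ e → + suc r * e + -[1+ 0 ] * (dot n x z * e)) (eval-shiftPoly n x r z z²≡1) ⟩
  + suc r * shiftProd r (dot n x z) + -[1+ 0 ] * (dot n x z * shiftProd r (dot n x z))
    ≡⟨ ring (+ suc r) (dot n x z) (shiftProd r (dot n x z)) ⟩
  shiftProd (suc r) (dot n x z) ∎
  where
  open ≡-Reasoning
  F = shiftPoly n x r
  R = raise n r F
  D = mulDot n r x F
  ring : ∀ a s e → a * e + -[1+ 0 ] * (s * e) ≡ (a - s) * e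
  ring = solve-∀

-- Linear algebra and arithmetic modulo a prime

-- Row l of pivotReduce v j₀ is a₀ vₗ′ − aₗ v_{j₀} without its first entry, where aᵢ is the
-- first entry of row i and l ↦ l′ skips j₀; pivotLift turns a relation among these rows
-- into one among the rows of v.
pivotReduce : ∀ {d m} → (Fin (suc m) → Fin (suc d) → ℤ) → Fin (suc m) → Fin m → Fin d → ℤ
pivotReduce v j₀ l t = v j₀ zero * v (punchIn j₀ l) (suc t) - v (punchIn j₀ l) zero * v j₀ (suc t)

pivotLift : ∀ {d m} → (Fin (suc m) → Fin (suc d) → ℤ) → Fin (suc m) → (Fin m → ℤ) → Fin (suc m) → ℤ
pivotLift {m = m} v j₀ c′ =
  insertAt (λ l → v j₀ zero * c′ l) j₀ (- sumFin m (λ l → c′ l * v (punchIn j₀ l) zero))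

module _ {d m} (v : Fin (suc m) → Fin (suc d) → ℤ) (j₀ : Fin (suc m)) (c′ : Fin m → ℤ) where
  private
    a₀ = v j₀ zero
    S = sumFin m (λ l → c′ l * v (punchIn j₀ l) zero)

  pivotLift-split : ∀ t → sumFin (suc m) (λ j → pivotLift v j₀ c′ j * v j t) ≡
                          - S * v j₀ t + sumFin m (λ l → a₀ * c′ l * v (punchIn j₀ l) t)
  pivotLift-split t = trans (sumFin-punchIn m j₀ (λ j → pivotLift v j₀ c′ j * v j t))
    (cong₂ _+_ (cong (_* v j₀ t) (insertAt-lookup _ j₀ (- S)))
               (sumFin-cong m (λ l → cong (_* v (punchIn j₀ l) t) (insertAt-punchIn _ j₀ (- S) l))))

  pivotLift-first : sumFin (suc m) (λ j → pivotLift v j₀ c′ j * v j zero) ≡ + 0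
  pivotLift-first = begin
    sumFin (suc m) (λ j → pivotLift v j₀ c′ j * v j zero)
      ≡⟨ pivotLift-split zero ⟩
    - S * a₀ + sumFin m (λ l → a₀ * c′ l * v (punchIn j₀ l) zero)
      ≡⟨ cong (_+_ (- S * a₀)) (sumFin-cong m (λ l → ℤP.*-assoc a₀ (c′ l) _)) ⟩
    - S * a₀ + sumFin m (λ l → a₀ * (c′ l * v (punchIn j₀ l) zero))
      ≡⟨ cong (_+_ (- S * a₀)) (sumFin-*ˡ m a₀ _) ⟩
    - S * a₀ + a₀ * S
      ≡⟨ ring S a₀ ⟩
    + 0 ∎
    where
    open ≡-Reasoning
    ring : ∀ s x → - s * x + x * s ≡ + 0
    ring = solve-∀

  pivotLift-rest : ∀ t → sumFin (suc m) (λ j → pivotLift v j₀ c′ j * v j (suc t)) ≡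
                         sumFin m (λ l → c′ l * pivotReduce v j₀ l t)
  pivotLift-rest t = begin
    sumFin (suc m) (λ j → pivotLift v j₀ c′ j * v j (suc t))
      ≡⟨ pivotLift-split (suc t) ⟩
    - S * V + T
      ≡⟨ ring₁ S V T ⟩
    T + - V * S
      ≡⟨ cong (_+_ T) (sym (sumFin-*ˡ m (- V) _)) ⟩
    T + sumFin m (λ l → - V * (c′ l * v (punchIn j₀ l) zero))
      ≡⟨ sym (sumFin-+ m _ _) ⟩
    sumFin m (λ l → a₀ * c′ l * v (punchIn j₀ l) (suc t) + - V * (c′ l * v (punchIn j₀ l) zero))
      ≡⟨ sumFin-cong m (λ l → ring₂ a₀ (c′ l) (v (punchIn j₀ l) (suc t)) (v (punchIn j₀ l) zero) V) ⟩
    sumFin m (λ l → c′ l * pivotReduce v j₀ l t) ∎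
    where
    open ≡-Reasoning
    V = v j₀ (suc t)
    T = sumFin m (λ l → a₀ * c′ l * v (punchIn j₀ l) (suc t))
    ring₁ : ∀ s x y → - s * x + y ≡ y + - x * s
    ring₁ = solve-∀
    ring₂ : ∀ x y u b V → x * y * u + - V * (y * b) ≡ y * (x * u - b * V)
    ring₂ = solve-∀

∣shiftProd : ∀ {q} r k s → k ℕ.< r → q ∣ + suc k - s → q ∣ shiftProd r s
∣shiftProd (suc r) k s k<1+r q∣factor with ℕP.m≤n⇒m<n∨m≡n k<1+r
... | inj₁ (ℕ.s≤s k<r) = ∣n⇒∣m*n (+ suc r - s) (∣shiftProd r k s k<r q∣factor)
... | inj₂ refl        = ∣m⇒∣m*n _ q∣factor

multiple<⇒0 : ∀ N w → w * + N ℤ.< + N → - (w * + N) ℤ.< + N → w ≡ + 0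
multiple<⇒0 N (+ zero)  _   _    = refl
multiple<⇒0 N (+ suc k) w*N<N _  =
  ⊥-elim $ ℤP.<⇒≱ w*N<N (subst (+ N ℤ.≤_) (ℤP.pos-* (suc k) N) (ℤ.+≤+ (ℕP.m≤n*m N (suc k))))
multiple<⇒0 N -[1+ k ]  _  -w*N<N =
  ⊥-elim $ ℤP.<⇒≱ -w*N<N (subst (+ N ℤ.≤_) (trans (ℤP.pos-* (suc k) N) (sym (ℤP.neg-distribˡ-* -[1+ k ] (+ N))))
                       (ℤ.+≤+ (ℕP.m≤n*m N (suc k))))

module ModPrime (p : ℕ) (p-prime : Prime p) where

  euclid : ∀ a b → + p ∣ a * b → + p ∣ a ⊎ + p ∣ b
  euclid a b p∣ab
    with euclidsLemma ℤ.∣ a ∣ ℤ.∣ b ∣ p-prime (subst (p ℕD.∣_) (ℤP.abs-* a b) (∣⇒∣ᵤ p∣ab))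
  ... | inj₁ p∣a = inj₁ (∣ᵤ⇒∣ p∣a)
  ... | inj₂ p∣b = inj₂ (∣ᵤ⇒∣ p∣b)

  p∤1 : ¬ (+ p ∣ + 1)
  p∤1 p∣1 = ¬prime[1] (subst Prime (ℕD.∣1⇒≡1 (∣⇒∣ᵤ p∣1)) p-prime)

  LinearlyDependent : ∀ {d m} → (Fin m → Fin d → ℤ) → Set
  LinearlyDependent {d} {m} v =
    Σ (Fin m → ℤ) λ c → (∃[ j ] ¬ (+ p ∣ c j)) × (∀ t → + p ∣ sumFin m (λ j → c j * v j t))

  linearlyDependent : ∀ {d m} → d ℕ.< m → (v : Fin m → Fin d → ℤ) → LinearlyDependent v
  eliminate : ∀ {d m} (v : Fin (suc m) → Fin (suc d) → ℤ) (j₀ : Fin (suc m)) →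
    ¬ (+ p ∣ v j₀ zero) → d ℕ.< m → LinearlyDependent v

  linearlyDependent {zero}  {suc m} _ v = (λ _ → + 1) , (zero , p∤1) , λ ()
  linearlyDependent {suc d} {suc (suc m)} (ℕ.s≤s (ℕ.s≤s d<m)) v
    with FinP.any? (λ j → ¬? (+ p ∣? v j zero))
  ... | yes (j₀ , p∤pivot) = eliminate v j₀ p∤pivot (ℕ.s≤s d<m)
  ... | no no-pivot = c , nonzero , combination
    where
    first-divisible : ∀ j → + p ∣ v j zero
    first-divisible j with + p ∣? v j zero
    ... | yes p∣vj = p∣vj
    ... | no p∤vj = ⊥-elim (no-pivot (j , p∤vj))
    dep = linearlyDependent (ℕ.s≤s (ℕP.m≤n⇒m≤1+n d<m)) (λ j t → v j (suc t))
    c = proj₁ dep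
    nonzero = proj₁ (proj₂ dep)
    combination : ∀ t → + p ∣ sumFin (suc (suc m)) (λ j → c j * v j t)
    combination zero    = ∣sumFin _ _ (λ j → ∣n⇒∣m*n (c j) (first-divisible j))
    combination (suc t) = proj₂ (proj₂ dep) t

  eliminate {d} {m} v j₀ p∤a₀ d<m =
    pivotLift v j₀ c′ , (punchIn j₀ l , p∤cl) , combination
    where
    dep = linearlyDependent d<m (pivotReduce v j₀)
    c′ = proj₁ dep
    l = proj₁ (proj₁ (proj₂ dep))
    p∤cl : ¬ (+ p ∣ pivotLift v j₀ c′ (punchIn j₀ l))
    p∤cl p∣cl with euclid (v j₀ zero) (c′ l) (subst (+ p ∣_) (insertAt-punchIn _ j₀ _ l) p∣cl)
    ... | inj₁ p∣a₀  = p∤a₀ p∣a₀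
    ... | inj₂ p∣c′l = proj₂ (proj₁ (proj₂ dep)) p∣c′l
    combination : ∀ t → + p ∣ sumFin (suc m) (λ j → pivotLift v j₀ c′ j * v j t)
    combination zero    = subst (+ p ∣_) (sym (pivotLift-first v j₀ c′)) (divides (+ 0) refl)
    combination (suc t) = subst (+ p ∣_) (sym (pivotLift-rest v j₀ c′ t)) (proj₂ (proj₂ dep) t)

  -- Evaluating a relation among the Pⱼ at zₗ kills every term but the l-th.
  diagonalCriterion : ∀ {n r m} (P : Fin m → Poly n r) (z : Fin m → Pt n) →
    (∀ l → ¬ (+ p ∣ eval n r (P l) (z l))) → (∀ j l → j ≢ l → + p ∣ eval n r (P j) (z l)) →
    ¬ (dim n r ℕ.< m)
  diagonalCriterion {n} {r} {suc m} P z diagonal offDiagonal dim<m = diagonal l p∣Pl[zl]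
    where
    dep = linearlyDependent dim<m P
    c = proj₁ dep
    l = proj₁ (proj₁ (proj₂ dep))
    p∤cl = proj₂ (proj₁ (proj₂ dep))
    values = λ j → c j * eval n r (P j) (z l)
    p∣total : + p ∣ sumFin (suc m) values
    p∣total = subst (+ p ∣_) (eval-sumFin n r (suc m) c P (z l))
      (∣eval n r _ (z l) (proj₂ (proj₂ dep)))
    p∣others : + p ∣ sumFin m (λ j → values (punchIn l j))
    p∣others = ∣sumFin m _ (λ j → ∣n⇒∣m*n (c (punchIn l j)) (offDiagonal _ l (FinP.punchInᵢ≢i l j)))
    p∣Pl[zl] : + p ∣ eval n r (P l) (z l)
    p∣Pl[zl] with euclid (c l) _ (∣m+n∣n⇒∣m (subst (+ p ∣_) (sumFin-punchIn m l values) p∣total) p∣others)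
    ... | inj₁ p∣cl = ⊥-elim (p∤cl p∣cl)
    ... | inj₂ p∣Pl = p∣Pl

  instance
    p≢0 : ℕ.NonZero p
    p≢0 = prime⇒nonZero p-prime

  -- The factors k − s (0 < k < p) cover every residue except that of −s, which is nonzero.
  p∣shiftProd : ∀ r → suc r ≡ p → ∀ s → ¬ (+ p ∣ s) → + p ∣ shiftProd r s
  p∣shiftProd r 1+r≡p s p∤s with s %ℕ p | n%ℕd<d s p | a≡a%ℕn+[a/ℕn]*n s p
  ... | zero  | _       | s≡ = ⊥-elim (p∤s (divides (s /ℕ p) (trans s≡ (ℤP.+-identityˡ _))))
  ... | suc k | 1+k<p | s≡ =
    ∣shiftProd r k s (ℕP.≤-pred (subst (suc (suc k) ℕ.≤_) (sym 1+r≡p) 1+k<p))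
      (divides (- (s /ℕ p)) (trans (cong (_-_ (+ suc k)) s≡) (ring (+ suc k) (s /ℕ p) (+ p))))
    where
    ring : ∀ k Q p → k - (k + Q * p) ≡ - Q * p
    ring = solve-∀

  p∤shiftProd : ∀ r → r ℕ.< p → ∀ s → + p ∣ s → ¬ (+ p ∣ shiftProd r s)
  p∤shiftProd zero    _   s p∣s = p∤1
  p∤shiftProd (suc r) r<p s p∣s p∣prod with euclid (+ suc r - s) (shiftProd r s) p∣prod
  ... | inj₂ p∣rest   = p∤shiftProd r (ℕP.<-trans (ℕP.n<1+n r) r<p) s p∣s p∣rest
  ... | inj₁ p∣factor = ℕP.<⇒≱ r<p (ℕD.∣⇒≤ (∣⇒∣ᵤ p∣1+r))
    where
    p∣1+r : + p ∣ + suc r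
    p∣1+r = subst (+ p ∣_) (ring (+ suc r) s) (∣m∣n⇒∣m+n p∣factor p∣s)
      where
      ring : ∀ a b → a - b + b ≡ a
      ring = solve-∀

  p∤smallMultiple : ∀ a u → ¬ (+ p ∣ + a) → + a * u ≢ + 0 →
    + a * u ℤ.< + (a ℕ.* p) → - (+ a * u) ℤ.< + (a ℕ.* p) → ¬ (+ p ∣ + a * u)
  p∤smallMultiple a u p∤a au≢0 au<ap -au<ap p∣au with euclid (+ a) u p∣au
  ... | inj₁ p∣a = p∤a p∣a
  ... | inj₂ (divides w u≡wp) = au≢0 (begin
    + a * u              ≡⟨ au≡w[ap] ⟩
    w * + (a ℕ.* p)      ≡⟨ cong (_* + (a ℕ.* p)) w≡0 ⟩
    + 0                  ∎)
    where
    open ≡-Reasoning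
    au≡w[ap] : + a * u ≡ w * + (a ℕ.* p)
    au≡w[ap] = begin
      + a * u              ≡⟨ cong (+ a *_) u≡wp ⟩
      + a * (w * + p)      ≡⟨ ring (+ a) w (+ p) ⟩
      w * (+ a * + p)      ≡⟨ cong (w *_) (ℤP.pos-* a p) ⟨
      w * + (a ℕ.* p)      ∎
      where
      ring : ∀ a w p → a * (w * p) ≡ w * (a * p)
      ring = solve-∀
    w≡0 : w ≡ + 0
    w≡0 = multiple<⇒0 (a ℕ.* p) w (subst (ℤ._< _) au≡w[ap] au<ap) (subst (λ e → - e ℤ.< _) au≡w[ap] -au<ap)

IsSign : ℤ → Set
IsSign a = (a ≡ + 1) ⊎ (a ≡ -[1+ 0 ])

sign² : ∀ {a} → IsSign a → a * a ≡ + 1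
sign² (inj₁ refl) = refl
sign² (inj₂ refl) = refl

sign-* : ∀ {a b} → IsSign a → IsSign b → IsSign (a * b)
sign-* (inj₁ refl) (inj₁ refl) = inj₁ refl
sign-* (inj₁ refl) (inj₂ refl) = inj₂ refl
sign-* (inj₂ refl) (inj₁ refl) = inj₂ refl
sign-* (inj₂ refl) (inj₂ refl) = inj₁ refl

sign-neg : ∀ {a} → IsSign a → IsSign (- a)
sign-neg (inj₁ refl) = inj₂ refl
sign-neg (inj₂ refl) = inj₁ refl

sign≤1 : ∀ {a} → IsSign a → a ℤ.≤ + 1
sign≤1 (inj₁ refl) = ℤP.≤-refl
sign≤1 (inj₂ refl) = ℤ.-≤+

sign-*-≢ : ∀ {a b} → IsSign a → IsSign b → a ≢ b → a * b ≡ -[1+ 0 ]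
sign-*-≢ (inj₁ refl) (inj₁ refl) a≢b = ⊥-elim (a≢b refl)
sign-*-≢ (inj₁ refl) (inj₂ refl) a≢b = refl
sign-*-≢ (inj₂ refl) (inj₁ refl) a≢b = refl
sign-*-≢ (inj₂ refl) (inj₂ refl) a≢b = ⊥-elim (a≢b refl)

prodFin : ∀ n → (Fin n → ℤ) → ℤ
prodFin zero    a = + 1
prodFin (suc n) a = a zero * prodFin n (tail a)

prodFin-sign : ∀ n a → (∀ i → IsSign (a i)) → IsSign (prodFin n a)
prodFin-sign zero    a signs = inj₁ refl
prodFin-sign (suc n) a signs = sign-* (signs zero) (prodFin-sign n (tail a) (λ i → signs (suc i)))

prodFin-* : ∀ n a b → prodFin n (λ i → a i * b i) ≡ prodFin n a * prodFin n b
prodFin-* zero    a b = refl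
prodFin-* (suc n) a b rewrite prodFin-* n (tail a) (tail b) = ring (a zero) (b zero) _ _
  where
  ring : ∀ x y u v → x * y * (u * v) ≡ x * u * (y * v)
  ring = solve-∀

signSum≡n-1+prod-mod4 : ∀ n a → (∀ i → IsSign (a i)) → ∃[ t ] sumFin n a ≡ + n - + 1 + prodFin n a + + 4 * t
signSum≡n-1+prod-mod4 zero    a signs = + 0 , refl
signSum≡n-1+prod-mod4 (suc n) a signs
  with signSum≡n-1+prod-mod4 n (tail a) (λ i → signs (suc i))
     | signs zero
     | prodFin-sign n (tail a) (λ i → signs (suc i))
... | t , e | inj₁ a₀≡1  | _         rewrite a₀≡1  | e         = t , ring₁ (+ n) (prodFin n (tail a)) t
  where
  ring₁ : ∀ N P t → + 1 + (N - + 1 + P + + 4 * t) ≡ + 1 + N - + 1 + + 1 * P + + 4 * t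
  ring₁ = solve-∀
... | t , e | inj₂ a₀≡-1 | inj₁ P≡1  rewrite a₀≡-1 | e | P≡1  = t , ring₂ (+ n) t
  where
  ring₂ : ∀ N t → -[1+ 0 ] + (N - + 1 + + 1 + + 4 * t) ≡ + 1 + N - + 1 + -[1+ 0 ] * + 1 + + 4 * t
  ring₂ = solve-∀
... | t , e | inj₂ a₀≡-1 | inj₂ P≡-1 rewrite a₀≡-1 | e | P≡-1 = t - + 1 , ring₃ (+ n) t
  where
  ring₃ : ∀ N t →
    -[1+ 0 ] + (N - + 1 + -[1+ 0 ] + + 4 * t) ≡ + 1 + N - + 1 + -[1+ 0 ] * -[1+ 0 ] + + 4 * (t - + 1)
  ring₃ = solve-∀

signSum≤n : ∀ n a → (∀ i → IsSign (a i)) → sumFin n a ℤ.≤ + n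
signSum≤n zero    a signs = ℤP.≤-refl
signSum≤n (suc n) a signs = ℤP.+-mono-≤ (sign≤1 (signs zero)) (signSum≤n n (tail a) (λ i → signs (suc i)))

signSum<n : ∀ n a → (∀ i → IsSign (a i)) → ∀ j → a j ≡ -[1+ 0 ] → sumFin n a ℤ.< + n
signSum<n (suc n) a signs zero a₀≡-1 rewrite a₀≡-1 =
  ℤP.+-mono-<-≤ ℤ.-<+ (signSum≤n n (tail a) (λ i → signs (suc i)))
signSum<n (suc n) a signs (suc j) aj≡-1 =
  ℤP.+-mono-≤-< (sign≤1 (signs zero)) (signSum<n n (tail a) (λ i → signs (suc i)) j aj≡-1)

sumFin-neg : ∀ n a → - sumFin n a ≡ sumFin n (λ i → - a i)
sumFin-neg zero    a = refl
sumFin-neg (suc n) a = trans (ℤP.neg-distrib-+ (a zero) _) (cong (_+_ (- a zero)) (sumFin-neg n (tail a)))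

-signSum<n : ∀ n a → (∀ i → IsSign (a i)) → ∀ j → a j ≡ + 1 → - sumFin n a ℤ.< + n
-signSum<n n a signs j aj≡1 = subst (ℤ._< + n) (sym (sumFin-neg n a))
  (signSum<n n (λ i → - a i) (λ i → sign-neg (signs i)) j (cong -_ aj≡1))

dot<n : ∀ n x y → (∀ i → IsSign (x i)) → (∀ i → IsSign (y i)) → ∀ j → x j ≢ y j → dot n x y ℤ.< + n
dot<n n x y x± y± j xj≢yj =
  signSum<n n (λ i → x i * y i) (λ i → sign-* (x± i) (y± i)) j (sign-*-≢ (x± j) (y± j) xj≢yj)

-dot<n : ∀ n x y → (∀ i → IsSign (x i)) → (∀ i → IsSign (y i)) → ∀ j → x j ≡ y j → - dot n x y ℤ.< + n
-dot<n n x y x± y± j xj≡yj =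
  -signSum<n n (λ i → x i * y i) (λ i → sign-* (x± i) (y± i)) j
    (trans (cong (x j *_) (sym xj≡yj)) (sign² (x± j)))

EvenSign : ∀ n → Pt n → Set
EvenSign n x = (∀ i → IsSign (x i)) × (prodFin n x ≡ + 1)

dot≡n+4t : ∀ n x y → EvenSign n x → EvenSign n y → ∃[ t ] dot n x y ≡ + n + + 4 * t
dot≡n+4t n x y (x± , ∏x≡1) (y± , ∏y≡1)
  with signSum≡n-1+prod-mod4 n (λ i → x i * y i) (λ i → sign-* (x± i) (y± i))
... | t , e = t , (begin
  dot n x y                                            ≡⟨ e ⟩
  + n - + 1 + prodFin n (λ i → x i * y i) + + 4 * t    ≡⟨ cong (λ P → + n - + 1 + P + + 4 * t) ∏xy≡1 ⟩
  + n - + 1 + + 1 + + 4 * t                            ≡⟨ ring (+ n) t ⟩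
  + n + + 4 * t                                        ∎)
  where
  open ≡-Reasoning
  ∏xy≡1 : prodFin n (λ i → x i * y i) ≡ + 1
  ∏xy≡1 = trans (prodFin-* n x y) (cong₂ _*_ ∏x≡1 ∏y≡1)
  ring : ∀ N t → N - + 1 + + 1 + + 4 * t ≡ N + + 4 * t
  ring = solve-∀

-- A family of 2ᵐ points of M

pow2 : ℕ → ℕ
pow2 zero    = 1
pow2 (suc m) = pow2 m ℕ.+ pow2 m

cube : ∀ m → Fin (pow2 m) → Pt m
cube zero    i ()
cube (suc m) = (λ a → + 1 ∷ cube m a) ++ (λ a → -[1+ 0 ] ∷ cube m a)

cube-sign : ∀ m i j → IsSign (cube m i j)
cube-sign (suc m) i j with splitAt (pow2 m) i
cube-sign (suc m) i zero    | inj₁ a = inj₁ refl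
cube-sign (suc m) i (suc j) | inj₁ a = cube-sign m a j
cube-sign (suc m) i zero    | inj₂ a = inj₂ refl
cube-sign (suc m) i (suc j) | inj₂ a = cube-sign m a j

splitAt-injective : ∀ m n {i j : Fin (m ℕ.+ n)} → splitAt m i ≡ splitAt m j → i ≡ j
splitAt-injective m n {i} {j} eq = begin
  i                      ≡⟨ FinP.join-splitAt m n i ⟨
  join m n (splitAt m i) ≡⟨ cong (join m n) eq ⟩
  join m n (splitAt m j) ≡⟨ FinP.join-splitAt m n j ⟩
  j                      ∎
  where open ≡-Reasoning

cube-separates : ∀ m i i′ → i ≢ i′ → ∃[ j ] cube m i j ≢ cube m i′ j
cube-separates zero    zero zero i≢i′ = ⊥-elim (i≢i′ refl)
cube-separates (suc m) i i′ i≢i′ with splitAt (pow2 m) i in eq | splitAt (pow2 m) i′ in eq′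
... | inj₁ a | inj₂ a′ = zero , λ ()
... | inj₂ a | inj₁ a′ = zero , λ ()
... | inj₁ a | inj₁ a′ = let j , differ = cube-separates m a a′ a≢a′ in suc j , differ
  where
  a≢a′ : a ≢ a′
  a≢a′ a≡a′ = i≢i′ (splitAt-injective (pow2 m) (pow2 m) (trans eq (trans (cong inj₁ a≡a′) (sym eq′))))
... | inj₂ a | inj₂ a′ = let j , differ = cube-separates m a a′ a≢a′ in suc j , differ
  where
  a≢a′ : a ≢ a′
  a≢a′ a≡a′ = i≢i′ (splitAt-injective (pow2 m) (pow2 m) (trans eq (trans (cong inj₂ a≡a′) (sym eq′))))

minusOnePow : ℕ → ℤ
minusOnePow zero    = + 1
minusOnePow (suc k) = - minusOnePow k

minusOnePow≡1⇒even : ∀ k → minusOnePow k ≡ + 1 → 2 ℕD.∣ k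
minusOnePow≡1⇒even zero          _  = ℕD.divides 0 refl
minusOnePow≡1⇒even (suc zero)    ()
minusOnePow≡1⇒even (suc (suc k)) e =
  ℕD.∣m∣n⇒∣m+n (ℕD.∣-refl {2}) (minusOnePow≡1⇒even k (trans (sym (ℤP.neg-involutive _)) e))

prodFin≡minusOnePow : ∀ n x → (∀ i → IsSign (x i)) → prodFin n x ≡ minusOnePow (countNeg n x)
prodFin≡minusOnePow zero    x x± = refl
prodFin≡minusOnePow (suc n) x x± with x± zero
... | inj₁ x₀≡1  rewrite x₀≡1  =
  trans (ℤP.*-identityˡ _) (prodFin≡minusOnePow n (tail x) (λ i → x± (suc i)))
... | inj₂ x₀≡-1 rewrite x₀≡-1 =
  trans (ℤP.-1*i≡-i _) (cong -_ (prodFin≡minusOnePow n (tail x) (λ i → x± (suc i))))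

-- The second coordinate makes the product of all coordinates 1.
toM : ∀ m → Pt m → Pt (suc (suc m))
toM m w = + 1 ∷ (prodFin m w ∷ w)

module _ (m : ℕ) (w : Pt m) (w± : ∀ j → IsSign (w j)) where

  toM-sign : ∀ i → IsSign (toM m w i)
  toM-sign zero          = inj₁ refl
  toM-sign (suc zero)    = prodFin-sign m w w±
  toM-sign (suc (suc j)) = w± j

  toM-even : EvenSign (suc (suc m)) (toM m w)
  toM-even = toM-sign , trans (ℤP.*-identityˡ _) (sign² (prodFin-sign m w w±))

  toM-InM : InM (suc (suc m)) (toM m w)
  toM-InM = toM-sign , first≡1 ,
    minusOnePow≡1⇒even _ (trans (sym (prodFin≡minusOnePow _ _ toM-sign)) (proj₂ toM-even))
    where
    first≡1 : ∀ i → toℕ i ≡ 0 → toM m w i ≡ + 1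
    first≡1 zero    _  = refl
    first≡1 (suc _) ()

-- Pigeonhole principle

δ : ∀ {K} → Fin K → Fin K → ℕ
δ zero    zero    = 1
δ zero    (suc _) = 0
δ (suc _) zero    = 0
δ (suc a) (suc b) = δ a b

δ-view : ∀ {K} (a b : Fin K) → (a ≡ b × δ a b ≡ 1) ⊎ δ a b ≡ 0
δ-view zero    zero    = inj₁ (refl , refl)
δ-view zero    (suc b) = inj₂ refl
δ-view (suc a) zero    = inj₂ refl
δ-view (suc a) (suc b) with δ-view a b
... | inj₁ (a≡b , δ≡1) = inj₁ (cong suc a≡b , δ≡1)
... | inj₂ δ≡0         = inj₂ δ≡0

∑δ≡1 : ∀ {K} (a : Fin K) → ∑[ κ < K ] δ a κ ≡ 1
∑δ≡1 {suc K} zero    = cong suc (∑0≡0 K)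
  where
  ∑0≡0 : ∀ K → ∑[ κ < K ] 0 ≡ 0
  ∑0≡0 zero    = refl
  ∑0≡0 (suc K) = ∑0≡0 K
∑δ≡1 {suc K} (suc a) = ∑δ≡1 a

count : ∀ {N K} → (Fin N → Fin K) → Fin K → ℕ
count {N} col κ = ∑[ i < N ] δ (col i) κ

∑count≡N : ∀ {N K} (col : Fin N → Fin K) → ∑[ κ < K ] count col κ ≡ N
∑count≡N {N} {K} col = begin
  ∑[ κ < K ] ∑[ i < N ] δ (col i) κ  ≡⟨ ∑-comm (λ κ i → δ (col i) κ) ⟩
  ∑[ i < N ] ∑[ κ < K ] δ (col i) κ  ≡⟨ sum-cong-≗ (λ i → ∑δ≡1 (col i)) ⟩
  ∑[ i < N ] 1                        ≡⟨ ∑1≡N N ⟩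
  N                                   ∎
  where
  open ≡-Reasoning
  ∑1≡N : ∀ N → ∑[ i < N ] 1 ≡ N
  ∑1≡N zero    = refl
  ∑1≡N (suc N) = cong suc (∑1≡N N)

∑≤K*d : ∀ K d (g : Fin K → ℕ) → (∀ κ → g κ ℕ.≤ d) → ∑[ κ < K ] g κ ℕ.≤ K ℕ.* d
∑≤K*d zero    d g g≤d = ℕ.z≤n
∑≤K*d (suc K) d g g≤d = ℕP.+-mono-≤ (g≤d zero) (∑≤K*d K d (tail g) (λ κ → g≤d (suc κ)))

Monochromatic : ∀ {N K} → (Fin N → Fin K) → Fin K → ℕ → Set
Monochromatic {N} col κ s =
  Σ (Fin s → Fin N) λ e → (∀ i j → e i ≡ e j → i ≡ j) × (∀ i → col (e i) ≡ κ)

monochromatic : ∀ {N K} (col : Fin N → Fin K) κ s → s ℕ.≤ count col κ → Monochromatic col κ s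
monochromatic col κ zero s≤count = (λ ()) , (λ ()) , (λ ())
monochromatic {suc N} col κ (suc s) s≤count with δ-view (col zero) κ
... | inj₁ (col₀≡κ , δ≡1) = e , e-injective , e-colour
  where
  rest = monochromatic (tail col) κ s
           (ℕP.≤-pred (subst (λ u → suc s ℕ.≤ u ℕ.+ count (tail col) κ) δ≡1 s≤count))
  e : Fin (suc s) → Fin (suc N)
  e zero    = zero
  e (suc i) = suc (proj₁ rest i)
  e-injective : ∀ i j → e i ≡ e j → i ≡ j
  e-injective zero    zero    _  = refl
  e-injective zero    (suc j) ()
  e-injective (suc i) zero    ()
  e-injective (suc i) (suc j) eq = cong suc (proj₁ (proj₂ rest) i j (FinP.suc-injective eq))
  e-colour : ∀ i → col (e i) ≡ κ
  e-colour zero    = col₀≡κ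
  e-colour (suc i) = proj₂ (proj₂ rest) i
... | inj₂ δ≡0 = (λ i → suc (proj₁ rest i)) , (λ i j eq → proj₁ (proj₂ rest) i j (FinP.suc-injective eq)) ,
                 proj₂ (proj₂ rest)
  where
  rest = monochromatic (tail col) κ (suc s) (subst (λ u → suc s ℕ.≤ u ℕ.+ count (tail col) κ) δ≡0 s≤count)

pigeonhole : ∀ {N K} d (col : Fin N → Fin K) → K ℕ.* d ℕ.< N → ∃[ κ ] Monochromatic col κ (suc d)
pigeonhole {N} {K} d col K*d<N with FinP.any? (λ κ → d ℕ.<? count col κ)
... | yes (κ , d<count) = κ , monochromatic col κ (suc d) d<count
... | no no-large = ⊥-elim (ℕP.<⇒≱ K*d<N (subst (ℕ._≤ K ℕ.* d) (∑count≡N col)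
        (∑≤K*d K d (count col) (λ κ → ℕP.≮⇒≥ (λ d<count → no-large (κ , d<count))))))

-- Size estimates

-- Σ_{i≤k} C(n, i) ≤ Σ_i C(n, i) 3^(k−i) = 3^k (4/3)^n.
dim-bound : ∀ n k → 3 ℕ.^ n ℕ.* dim n k ℕ.≤ 3 ℕ.^ k ℕ.* 4 ℕ.^ n
dim-bound zero    k = subst (1 ℕ.≤_) (sym (ℕP.*-identityʳ (3 ℕ.^ k))) (ℕP.m^n>0 3 k)
dim-bound (suc n) zero = begin
  3 ℕ.* 3 ℕ.^ n ℕ.* (dim n 0 ℕ.+ 0)  ≡⟨ ring₁ (3 ℕ.^ n) (dim n 0) ⟩
  3 ℕ.* (3 ℕ.^ n ℕ.* dim n 0)        ≤⟨ ℕP.*-mono-≤ (ℕP.n≤1+n 3) (dim-bound n 0) ⟩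
  4 ℕ.* (1 ℕ.* 4 ℕ.^ n)              ≡⟨ ring₂ (4 ℕ.^ n) ⟩
  1 ℕ.* (4 ℕ.* 4 ℕ.^ n)              ∎
  where
  open ℕP.≤-Reasoning
  ring₁ : ∀ x b → 3 ℕ.* x ℕ.* (b ℕ.+ 0) ≡ 3 ℕ.* (x ℕ.* b)
  ring₁ = ℕ-Ring.solve-∀
  ring₂ : ∀ y → 4 ℕ.* (1 ℕ.* y) ≡ 1 ℕ.* (4 ℕ.* y)
  ring₂ = ℕ-Ring.solve-∀
dim-bound (suc n) (suc k) = begin
  3 ℕ.* 3 ℕ.^ n ℕ.* (dim n (suc k) ℕ.+ dim n k)
    ≡⟨ ring₁ (3 ℕ.^ n) (dim n (suc k)) (dim n k) ⟩
  3 ℕ.* (3 ℕ.^ n ℕ.* dim n (suc k)) ℕ.+ 3 ℕ.* (3 ℕ.^ n ℕ.* dim n k)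
    ≤⟨ ℕP.+-mono-≤ (ℕP.*-monoʳ-≤ 3 (dim-bound n (suc k))) (ℕP.*-monoʳ-≤ 3 (dim-bound n k)) ⟩
  3 ℕ.* (3 ℕ.* 3 ℕ.^ k ℕ.* 4 ℕ.^ n) ℕ.+ 3 ℕ.* (3 ℕ.^ k ℕ.* 4 ℕ.^ n)
    ≡⟨ ring₂ (3 ℕ.^ k) (4 ℕ.^ n) ⟩
  3 ℕ.* 3 ℕ.^ k ℕ.* (4 ℕ.* 4 ℕ.^ n) ∎
  where
  open ℕP.≤-Reasoning
  ring₁ : ∀ x b c → 3 ℕ.* x ℕ.* (b ℕ.+ c) ≡ 3 ℕ.* (x ℕ.* b) ℕ.+ 3 ℕ.* (x ℕ.* c)
  ring₁ = ℕ-Ring.solve-∀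
  ring₂ : ∀ x y → 3 ℕ.* (3 ℕ.* x ℕ.* y) ℕ.+ 3 ℕ.* (x ℕ.* y) ≡ 3 ℕ.* x ℕ.* (4 ℕ.* y)
  ring₂ = ℕ-Ring.solve-∀

colours : ℕ → ℕ
colours p = 4 ℕ.* p ℕ.* (4 ℕ.* p) ℕ.+ 1

colours-ratio : ∀ p → 20 ℕ.≤ p → 16 ℕ.* colours (suc p) ℕ.≤ 27 ℕ.* colours p
colours-ratio p 20≤p =
  subst (λ u → 16 ℕ.* colours (suc u) ℕ.≤ 27 ℕ.* colours u) (ℕP.m+[n∸m]≡n 20≤p) (shifted (p ℕ.∸ 20))
  where
  expand : ∀ q → 27 ℕ.* (4 ℕ.* (20 ℕ.+ q) ℕ.* (4 ℕ.* (20 ℕ.+ q)) ℕ.+ 1) ≡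
                 16 ℕ.* (4 ℕ.* (1 ℕ.+ (20 ℕ.+ q)) ℕ.* (4 ℕ.* (1 ℕ.+ (20 ℕ.+ q))) ℕ.+ 1)
                   ℕ.+ (176 ℕ.* q ℕ.* q ℕ.+ 6528 ℕ.* q ℕ.+ 59915)
  expand = ℕ-Ring.solve-∀
  shifted : ∀ q → 16 ℕ.* colours (suc (20 ℕ.+ q)) ℕ.≤ 27 ℕ.* colours (20 ℕ.+ q)
  shifted q = subst (16 ℕ.* colours (suc (20 ℕ.+ q)) ℕ.≤_) (sym (expand q)) (ℕP.m≤m+n _ _)

colours-growth : ∀ p → 20 ℕ.≤ p → 4 ℕ.* colours p ℕ.* 16 ℕ.^ p ℕ.< 3 ℕ.* 27 ℕ.^ p
colours-growth p 20≤p with ℕP.m≤n⇒m<n∨m≡n 20≤p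
... | inj₂ refl = ℕP.<ᵇ⇒< _ _ tt
colours-growth (suc p) _ | inj₁ (ℕ.s≤s 20≤p) = begin-strict
  4 ℕ.* colours (suc p) ℕ.* (16 ℕ.* 16 ℕ.^ p)   ≡⟨ ring₁ (colours (suc p)) (16 ℕ.^ p) ⟩
  16 ℕ.* colours (suc p) ℕ.* (4 ℕ.* 16 ℕ.^ p)   ≤⟨ ℕP.*-monoˡ-≤ (4 ℕ.* 16 ℕ.^ p) (colours-ratio p 20≤p) ⟩
  27 ℕ.* colours p ℕ.* (4 ℕ.* 16 ℕ.^ p)         ≡⟨ ring₂ (colours p) (16 ℕ.^ p) ⟩
  27 ℕ.* (4 ℕ.* colours p ℕ.* 16 ℕ.^ p)         <⟨ ℕP.*-monoʳ-< 27 (colours-growth p 20≤p) ⟩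
  27 ℕ.* (3 ℕ.* 27 ℕ.^ p)                       ≡⟨ ring₃ (27 ℕ.^ p) ⟩
  3 ℕ.* (27 ℕ.* 27 ℕ.^ p)                       ∎
  where
  open ℕP.≤-Reasoning
  ring₁ : ∀ a x → 4 ℕ.* a ℕ.* (16 ℕ.* x) ≡ 16 ℕ.* a ℕ.* (4 ℕ.* x)
  ring₁ = ℕ-Ring.solve-∀
  ring₂ : ∀ a x → 27 ℕ.* a ℕ.* (4 ℕ.* x) ≡ 27 ℕ.* (4 ℕ.* a ℕ.* x)
  ring₂ = ℕ-Ring.solve-∀
  ring₃ : ∀ y → 27 ℕ.* (3 ℕ.* y) ≡ 3 ℕ.* (27 ℕ.* y)
  ring₃ = ℕ-Ring.solve-∀

^-distribʳ-* : ∀ a b p → (a ℕ.* b) ℕ.^ p ≡ a ℕ.^ p ℕ.* b ℕ.^ p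
^-distribʳ-* a b zero    = refl
^-distribʳ-* a b (suc p) rewrite ^-distribʳ-* a b p = ring a b (a ℕ.^ p) (b ℕ.^ p)
  where
  ring : ∀ a b x y → a ℕ.* b ℕ.* (x ℕ.* y) ≡ a ℕ.* x ℕ.* (b ℕ.* y)
  ring = ℕ-Ring.solve-∀

pow2≡2^ : ∀ m → pow2 m ≡ 2 ℕ.^ m
pow2≡2^ zero    = refl
pow2≡2^ (suc m) rewrite pow2≡2^ m = cong (2 ℕ.^ m ℕ.+_) (sym (ℕP.+-identityʳ (2 ℕ.^ m)))

-- With n = 4p: 81^p · dim n (p − 1) ≤ 3^(p−1) · 256^p by dim-bound, and 3^p · 256^p = 16^p · 48^p.
colours*dim<pow2 : ∀ p r m → 20 ℕ.≤ p → suc r ≡ p → suc (suc m) ≡ 4 ℕ.* p →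
  colours p ℕ.* dim (4 ℕ.* p) r ℕ.< pow2 m
colours*dim<pow2 p r m 20≤p 1+r≡p 2+m≡4p =
  ℕP.*-cancelˡ-< 4 _ _
    (subst₂ ℕ._<_ (ℕP.*-assoc 4 C d) 16^p≡4*pow2 (ℕP.*-cancelˡ-< (3 ℕ.* 81 ℕ.^ p) _ _ scaled))
  where
  C = colours p
  d = dim (4 ℕ.* p) r
  3^r*3≡3^p : 3 ℕ.* 3 ℕ.^ r ≡ 3 ℕ.^ p
  3^r*3≡3^p = cong (3 ℕ.^_) 1+r≡p
  dim-bound′ : 81 ℕ.^ p ℕ.* d ℕ.≤ 3 ℕ.^ r ℕ.* 256 ℕ.^ p
  dim-bound′ = subst₂ (λ a b → a ℕ.* d ℕ.≤ 3 ℕ.^ r ℕ.* b)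
    (sym (ℕP.^-*-assoc 3 4 p)) (sym (ℕP.^-*-assoc 4 4 p)) (dim-bound (4 ℕ.* p) r)
  scaled : 3 ℕ.* 81 ℕ.^ p ℕ.* (4 ℕ.* C ℕ.* d) ℕ.< 3 ℕ.* 81 ℕ.^ p ℕ.* 16 ℕ.^ p
  scaled = begin-strict
    3 ℕ.* 81 ℕ.^ p ℕ.* (4 ℕ.* C ℕ.* d)            ≡⟨ ring₁ (81 ℕ.^ p) C d ⟩
    4 ℕ.* C ℕ.* 3 ℕ.* (81 ℕ.^ p ℕ.* d)            ≤⟨ ℕP.*-monoʳ-≤ (4 ℕ.* C ℕ.* 3) dim-bound′ ⟩
    4 ℕ.* C ℕ.* 3 ℕ.* (3 ℕ.^ r ℕ.* 256 ℕ.^ p)     ≡⟨ ring₂ C (3 ℕ.^ r) (256 ℕ.^ p) ⟩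
    4 ℕ.* C ℕ.* (3 ℕ.* 3 ℕ.^ r ℕ.* 256 ℕ.^ p)     ≡⟨ cong (λ u → 4 ℕ.* C ℕ.* (u ℕ.* 256 ℕ.^ p)) 3^r*3≡3^p ⟩
    4 ℕ.* C ℕ.* (3 ℕ.^ p ℕ.* 256 ℕ.^ p)           ≡⟨ cong (4 ℕ.* C ℕ.*_) (trans (sym (^-distribʳ-* 3 256 p))
                                                                                (^-distribʳ-* 16 48 p)) ⟩
    4 ℕ.* C ℕ.* (16 ℕ.^ p ℕ.* 48 ℕ.^ p)           ≡⟨ ℕP.*-assoc (4 ℕ.* C) (16 ℕ.^ p) (48 ℕ.^ p) ⟨
    4 ℕ.* C ℕ.* 16 ℕ.^ p ℕ.* 48 ℕ.^ p             <⟨ ℕP.*-monoˡ-< (48 ℕ.^ p) {{ℕP.m^n≢0 48 p}} (colours-growth p 20≤p) ⟩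
    3 ℕ.* 27 ℕ.^ p ℕ.* 48 ℕ.^ p                   ≡⟨ ℕP.*-assoc 3 (27 ℕ.^ p) (48 ℕ.^ p) ⟩
    3 ℕ.* (27 ℕ.^ p ℕ.* 48 ℕ.^ p)                 ≡⟨ cong (3 ℕ.*_) (trans (sym (^-distribʳ-* 27 48 p))
                                                                          (^-distribʳ-* 81 16 p)) ⟩
    3 ℕ.* (81 ℕ.^ p ℕ.* 16 ℕ.^ p)                 ≡⟨ ℕP.*-assoc 3 (81 ℕ.^ p) (16 ℕ.^ p) ⟨
    3 ℕ.* 81 ℕ.^ p ℕ.* 16 ℕ.^ p                   ∎
    where
    open ℕP.≤-Reasoning
    ring₁ : ∀ a k d → 3 ℕ.* a ℕ.* (4 ℕ.* k ℕ.* d) ≡ 4 ℕ.* k ℕ.* 3 ℕ.* (a ℕ.* d)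
    ring₁ = ℕ-Ring.solve-∀
    ring₂ : ∀ k x y → 4 ℕ.* k ℕ.* 3 ℕ.* (x ℕ.* y) ≡ 4 ℕ.* k ℕ.* (3 ℕ.* x ℕ.* y)
    ring₂ = ℕ-Ring.solve-∀
  16^p≡4*pow2 : 16 ℕ.^ p ≡ 4 ℕ.* pow2 m
  16^p≡4*pow2 = begin
    16 ℕ.^ p               ≡⟨ ℕP.^-*-assoc 2 4 p ⟩
    2 ℕ.^ (4 ℕ.* p)        ≡⟨ cong (2 ℕ.^_) 2+m≡4p ⟨
    2 ℕ.* (2 ℕ.* 2 ℕ.^ m)  ≡⟨ ring (2 ℕ.^ m) ⟩
    4 ℕ.* 2 ℕ.^ m          ≡⟨ cong (4 ℕ.*_) (pow2≡2^ m) ⟨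
    4 ℕ.* pow2 m           ∎
    where
    open ≡-Reasoning
    ring : ∀ x → 2 ℕ.* (2 ℕ.* x) ≡ 4 ℕ.* x
    ring = ℕ-Ring.solve-∀

-- Distances in fM

distSq-f : ∀ n x y → (∀ i → IsSign (x i)) → (∀ i → IsSign (y i)) →
  distSq n (f n x) (f n y) + + 2 * (dot n x y * dot n x y) ≡ + 2 * + n * + n
distSq-f n x y x± y± = begin
  distSq n (f n x) (f n y) + + 2 * (S * S)  ≡⟨ cong (_+ + 2 * (S * S)) outer ⟩
  + 2 * + n * + n + -[1+ 1 ] * S * S + + 2 * (S * S) ≡⟨ ring (+ n) S ⟩
  + 2 * + n * + n ∎
  where
  open ≡-Reasoning
  a : Fin n → ℤ
  a i = x i * y i
  S = dot n x y
  entry : ∀ i j → (f n x i j - f n y i j) * (f n x i j - f n y i j) ≡ + 2 + -[1+ 1 ] * a i * a j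
  entry i j = trans (expand (x i) (x j) (y i) (y j))
    (cong₂ (λ u v → u + v + -[1+ 1 ] * a i * a j)
      (cong₂ _*_ (sign² (x± i)) (sign² (x± j))) (cong₂ _*_ (sign² (y± i)) (sign² (y± j))))
    where
    expand : ∀ xi xj yi yj → (xi * xj - yi * yj) * (xi * xj - yi * yj) ≡
                             xi * xi * (xj * xj) + yi * yi * (yj * yj) + -[1+ 1 ] * (xi * yi) * (xj * yj)
    expand = solve-∀
  row : ∀ i → sumFin n (λ j → (f n x i j - f n y i j) * (f n x i j - f n y i j)) ≡ + 2 * + n + -[1+ 1 ] * a i * S
  row i = trans (sumFin-cong n (entry i))
    (trans (sumFin-+ n (λ _ → + 2) (λ j → -[1+ 1 ] * a i * a j))
      (cong₂ _+_ (sumFin-const n (+ 2)) (sumFin-*ˡ n (-[1+ 1 ] * a i) a)))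
  outer : distSq n (f n x) (f n y) ≡ + 2 * + n * + n + -[1+ 1 ] * S * S
  outer = trans (sumFin-cong n row)
    (trans (sumFin-+ n (λ _ → + 2 * + n) (λ i → -[1+ 1 ] * a i * S))
      (cong₂ _+_ (sumFin-const n (+ 2 * + n))
        (trans (sumFin-cong n (λ i → swap (a i) S)) (sumFin-*ˡ n (-[1+ 1 ] * S) a))))
    where
    swap : ∀ u S → -[1+ 1 ] * u * S ≡ -[1+ 1 ] * S * u
    swap = solve-∀
  ring : ∀ N S → + 2 * N * N + -[1+ 1 ] * S * S + + 2 * (S * S) ≡ + 2 * N * N
  ring = solve-∀

0≤i*i : ∀ i → + 0 ℤ.≤ i * i
0≤i*i (+ k)     = subst (+ 0 ℤ.≤_) (ℤP.pos-* k k) (ℤ.+≤+ ℕ.z≤n)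
0≤i*i -[1+ k ]  = ℤ.+≤+ ℕ.z≤n

distSq-f≤ : ∀ n x y → (∀ i → IsSign (x i)) → (∀ i → IsSign (y i)) →
  distSq n (f n x) (f n y) ℤ.≤ + 2 * + n * + n
distSq-f≤ n x y x± y± = subst₂ ℤ._≤_ (ℤP.+-identityʳ _) (distSq-f n x y x± y±)
  (ℤP.+-monoʳ-≤ (distSq n (f n x) (f n y)) (ℤP.*-monoˡ-≤-nonNeg (+ 2) (0≤i*i (dot n x y))))

distSq-f-orthogonal : ∀ n x y → (∀ i → IsSign (x i)) → (∀ i → IsSign (y i)) → dot n x y ≡ + 0 →
  distSq n (f n x) (f n y) ≡ + 2 * + n * + n
distSq-f-orthogonal n x y x± y± x⊥y = begin
  distSq n (f n x) (f n y)                         ≡⟨ ℤP.+-identityʳ _ ⟨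
  distSq n (f n x) (f n y) + + 2 * (+ 0 * + 0)     ≡⟨ cong (λ S → distSq n (f n x) (f n y) + + 2 * (S * S)) x⊥y ⟨
  distSq n (f n x) (f n y) + + 2 * (dot n x y * dot n x y) ≡⟨ distSq-f n x y x± y± ⟩
  + 2 * + n * + n                                  ∎
  where open ≡-Reasoning

-- Every K-colouring of M ⊂ {±1}ⁿ has a monochromatic orthogonal pair, stated negatively
-- because the pair is not exhibited.
MonochromaticOrthogonalPair : ℕ → ℕ → Set
MonochromaticOrthogonalPair n K =
  (col : Pt n → Fin K) → ¬ (∀ x y → InM n x → InM n y → col x ≡ col y → dot n x y ≢ + 0)

-- The Frankl–Wilson argument for the points of M

module FranklWilson (p : ℕ) (p-prime : Prime p) (20≤p : 20 ℕ.≤ p)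
                    (r m : ℕ) (1+r≡p : suc r ≡ p) (n≡4p : suc (suc m) ≡ 4 ℕ.* p) where

  open ModPrime p p-prime

  n : ℕ
  n = suc (suc m)

  point : Fin (pow2 m) → Pt n
  point i = toM m (cube m i)

  point-sign : ∀ i j → IsSign (point i j)
  point-sign i = toM-sign m (cube m i) (cube-sign m i)

  p∤4 : ¬ (+ p ∣ + 4)
  p∤4 p∣4 = ℕP.<⇒≱ (ℕP.≤-trans (ℕ.s≤s (ℕ.s≤s (ℕ.s≤s (ℕ.s≤s (ℕ.s≤s ℕ.z≤n))))) 20≤p) (ℕD.∣⇒≤ (∣⇒∣ᵤ p∣4))

  -- ⟨x, y⟩ ≡ n ≡ 0 (mod 4) and |⟨x, y⟩| < n = 4p, so p ∣ ⟨x, y⟩ would force ⟨x, y⟩ = 0.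
  p∤dot : ∀ i i′ → i ≢ i′ → dot n (point i) (point i′) ≢ + 0 → ¬ (+ p ∣ dot n (point i) (point i′))
  p∤dot i i′ i≢i′ s≢0
    with dot≡n+4t n (point i) (point i′) (toM-even m _ (cube-sign m i)) (toM-even m _ (cube-sign m i′))
  ... | t , s≡n+4t = subst (λ s → ¬ (+ p ∣ s)) (sym s≡4u)
    (p∤smallMultiple 4 u p∤4 (subst (_≢ + 0) s≡4u s≢0)
      (subst (ℤ._< + n′) s≡4u upper) (subst (λ s → - s ℤ.< + n′) s≡4u lower))
    where
    n′ = 4 ℕ.* p
    u = + p + t
    s≡4u : dot n (point i) (point i′) ≡ + 4 * u
    s≡4u = begin
      dot n (point i) (point i′)  ≡⟨ s≡n+4t ⟩
      + n + + 4 * t               ≡⟨ cong (λ k → + k + + 4 * t) n≡4p ⟩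
      + (4 ℕ.* p) + + 4 * t       ≡⟨ cong (_+ + 4 * t) (ℤP.pos-* 4 p) ⟩
      + 4 * + p + + 4 * t         ≡⟨ ℤP.*-distribˡ-+ (+ 4) (+ p) t ⟨
      + 4 * u                     ∎
      where open ≡-Reasoning
    separation = cube-separates m i i′ i≢i′
    upper : dot n (point i) (point i′) ℤ.< + n′
    upper = subst (λ k → dot n (point i) (point i′) ℤ.< + k) n≡4p
      (dot<n n _ _ (point-sign i) (point-sign i′) (suc (suc (proj₁ separation))) (proj₂ separation))
    lower : - dot n (point i) (point i′) ℤ.< + n′
    lower = subst (λ k → - dot n (point i) (point i′) ℤ.< + k) n≡4p
      (-dot<n n _ _ (point-sign i) (point-sign i′) zero refl)

  orthogonalFree≤dim : ∀ {s} (e : Fin s → Fin (pow2 m)) → (∀ j l → e j ≡ e l → j ≡ l) →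
    (∀ j l → dot n (point (e j)) (point (e l)) ≢ + 0) → ¬ (dim n r ℕ.< s)
  orthogonalFree≤dim e e-injective non-orthogonal =
    diagonalCriterion (λ j → shiftPoly n (point (e j)) r) (λ j → point (e j)) diagonal offDiagonal
    where
    eval≡shiftProd : ∀ j l → eval n r (shiftPoly n (point (e j)) r) (point (e l)) ≡
                             shiftProd r (dot n (point (e j)) (point (e l)))
    eval≡shiftProd j l = eval-shiftPoly n (point (e j)) r (point (e l)) (λ k → sign² (point-sign (e l) k))
    p∣dot-self : ∀ l → + p ∣ dot n (point (e l)) (point (e l))
    p∣dot-self l = divides (+ 4) (begin
      dot n (point (e l)) (point (e l)) ≡⟨ dot-self n (point (e l)) (λ k → sign² (point-sign (e l) k)) ⟩
      + n                               ≡⟨ cong +_ n≡4p ⟩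
      + (4 ℕ.* p)                       ≡⟨ ℤP.pos-* 4 p ⟩
      + 4 * + p                         ∎)
      where open ≡-Reasoning
    diagonal : ∀ l → ¬ (+ p ∣ eval n r (shiftPoly n (point (e l)) r) (point (e l)))
    diagonal l = subst (λ v → ¬ (+ p ∣ v)) (sym (eval≡shiftProd l l))
      (p∤shiftProd r (subst (r ℕ.<_) 1+r≡p (ℕP.n<1+n r)) _ (p∣dot-self l))
    offDiagonal : ∀ j l → j ≢ l → + p ∣ eval n r (shiftPoly n (point (e j)) r) (point (e l))
    offDiagonal j l j≢l = subst (+ p ∣_) (sym (eval≡shiftProd j l))
      (p∣shiftProd r 1+r≡p _ (p∤dot (e j) (e l) (λ ej≡el → j≢l (e-injective j l ej≡el)) (non-orthogonal j l)))

  point-InM : ∀ i → InM n (point i)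
  point-InM i = toM-InM m (cube m i) (cube-sign m i)

  few-colours : colours p ℕ.* dim n r ℕ.< pow2 m
  few-colours = subst (λ k → colours p ℕ.* dim k r ℕ.< pow2 m) (sym n≡4p)
    (colours*dim<pow2 p r m 20≤p 1+r≡p n≡4p)

  monochromaticOrthogonalPair : MonochromaticOrthogonalPair n (colours p)
  monochromaticOrthogonalPair col non-orthogonal =
    orthogonalFree≤dim e e-injective
      (λ j l → non-orthogonal _ _ (point-InM (e j)) (point-InM (e l)) (trans (e-colour j) (sym (e-colour l))))
      ℕP.≤-refl
    where
    class = proj₂ (pigeonhole {K = colours p} (dim n r) (λ i → col (point i)) few-colours)
    e = proj₁ class
    e-injective = proj₁ (proj₂ class)
    e-colour = proj₂ (proj₂ class)

mainTheorem1 : ∃[ p₀ ] ∀ (p : ℕ) → Prime p → p₀ ℕ.< p →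
    ∀ (D : ℤ) → IsDiamSqFM (4 ℕ.* p) D →
      ¬ PartitionableSmaller (4 ℕ.* p) ((4 ℕ.* p) ℕ.* (4 ℕ.* p) ℕ.+ 1) D
mainTheorem1 = 20 , theorem
  where
  theorem : ∀ (p : ℕ) → Prime p → 20 ℕ.< p →
    ∀ (D : ℤ) → IsDiamSqFM (4 ℕ.* p) D →
      ¬ PartitionableSmaller (4 ℕ.* p) ((4 ℕ.* p) ℕ.* (4 ℕ.* p) ℕ.+ 1) D
  theorem p@(suc r) p-prime 20<p D (_ , x₀ , y₀ , x₀∈M , y₀∈M , d₀≡D) (col , col-small) =
    subst (λ k → MonochromaticOrthogonalPair k (colours p)) 2+m≡n
      (FranklWilson.monochromaticOrthogonalPair p p-prime (ℕP.<⇒≤ 20<p) r m refl 2+m≡n)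
      col non-orthogonal
    where
    n = 4 ℕ.* p
    m = n ℕ.∸ 2
    2+m≡n : suc (suc m) ≡ n
    2+m≡n = ℕP.m+[n∸m]≡n (ℕP.≤-trans (ℕ.s≤s (ℕ.s≤s ℕ.z≤n)) (ℕP.*-monoʳ-≤ 4 (ℕ.s≤s (ℕ.z≤n {r}))))
    D≤2n² : D ℤ.≤ + 2 * + n * + n
    D≤2n² = subst (ℤ._≤ _) d₀≡D (distSq-f≤ n x₀ y₀ (proj₁ x₀∈M) (proj₁ y₀∈M))
    non-orthogonal : ∀ x y → InM n x → InM n y → col x ≡ col y → dot n x y ≢ + 0
    non-orthogonal x y x∈M y∈M same x⊥y = ℤP.<⇒≱ (col-small x y x∈M y∈M same)
      (subst (D ℤ.≤_) (sym (distSq-f-orthogonal n x y (proj₁ x∈M) (proj₁ y∈M) x⊥y)) D≤2n²)
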